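{- Let $X$ be a finitely generated free abelian group, $k$ a positive integer, and $S$ a $k$-bounded linearly independent subset of $X$ with $r := |S|$. Let $Y$ be the subgroup spanned by $S$, and let $Z$ be a subgroup of $X$ containing $Y$ with $Z/Y$ finite. Then $[Z:Y] \le r!\,k^r$.
   Context: A subset $S$ of a free abelian group $X$ is $k$-bounded if there is a basis $(e_i)$ of $X$ such that every element of $S$ is a linear combination of the $e_i$ with integer coefficients in $[-k,k]$. -}

module Defs where

open import Data.Nat using (ℕ; zero; suc; _≤_)
open import Data.Integer using (ℤ; _+_; _*_; -_; ∣_∣) renaming (0ℤ to 0ℤ)
open import Data.Fin using (Fin; zero; suc)
open import Data.Product using (Σ; ∃; _×_)
open import Relation.Binary.PropositionalEquality using (_≡_)

ℤ^ : ℕ → Set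
ℤ^ n = Fin n → ℤ

_≈_ : ∀ {n} → ℤ^ n → ℤ^ n → Set
x ≈ y = ∀ j → x j ≡ y j

𝟎 : ∀ {n} → ℤ^ n
𝟎 _ = 0ℤ

_⊕_ : ∀ {n} → ℤ^ n → ℤ^ n → ℤ^ n
(x ⊕ y) j = x j + y j

⊖_ : ∀ {n} → ℤ^ n → ℤ^ n
(⊖ x) j = - x j

lincomb : ∀ {m n} → (Fin m → ℤ) → (Fin m → ℤ^ n) → ℤ^ n
lincomb {zero}  c v j = 0ℤ
lincomb {suc m} c v j = c zero * v zero j + lincomb (λ i → c (suc i)) (λ i → v (suc i)) j

LinearlyIndependent : ∀ {m n} → (Fin m → ℤ^ n) → Set
LinearlyIndependent v = ∀ c → lincomb c v ≈ 𝟎 → ∀ i → c i ≡ 0ℤ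

Spans : ∀ {m n} → (Fin m → ℤ^ n) → Set
Spans {n = n} v = ∀ (x : ℤ^ n) → ∃ λ c → lincomb c v ≈ x

IsBasis : ∀ {m n} → (Fin m → ℤ^ n) → Set
IsBasis v = LinearlyIndependent v × Spans v

InSpan : ∀ {m n} → (Fin m → ℤ^ n) → ℤ^ n → Set
InSpan v x = ∃ λ c → lincomb c v ≈ x

KBounded : ∀ {r n} → ℕ → (Fin r → ℤ^ n) → Set
KBounded {n = n} k s =
  Σ ℕ λ d → Σ (Fin d → ℤ^ n) λ e → IsBasis e ×
    (∀ i → ∃ λ c → (∀ j → ∣ c j ∣ ≤ k) × lincomb c e ≈ s i)

record IsSubgroup {n : ℕ} (Z : ℤ^ n → Set) : Set where
  field
    resp : ∀ {x y} → x ≈ y → Z x → Z y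
    zero-mem : Z 𝟎
    add-mem  : ∀ {x y} → Z x → Z y → Z (x ⊕ y)
    neg-mem  : ∀ {x} → Z x → Z (⊖ x)

-- t : Fin m → ℤ^n is a complete, irredundant system of representatives of
-- the cosets of Y = span(s) in Z; i.e. Z/Y is finite with [Z:Y] = m.
IsTransversal : ∀ {r n m} → (Z : ℤ^ n → Set) → (Fin r → ℤ^ n) → (Fin m → ℤ^ n) → Set
IsTransversal {m = m} Z s t =
  (∀ i → Z (t i)) ×
  (∀ z → Z z → ∃ λ (i : Fin m) → InSpan s (z ⊕ (⊖ t i))) ×
  (∀ i j → InSpan s (t i ⊕ (⊖ t j)) → i ≡ j)

{-# OPTIONS --safe #-}
module Submission where

-- Write the elements of s in the basis e as the rows of an r × d integer matrix A with entries
-- in [-k, k]. Euclidean operations between adjacent rows preserve the row lattice and every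
-- r × r minor, and bring A to echelon form with pivot columns ρ. Every element of Z has a
-- nonzero multiple in Y, and a vector of the row lattice is determined by its ρ-coordinates, so
-- the ρ-coordinates of a transversal are pairwise incongruent modulo the rows of the echelon
-- matrix P restricted to ρ. That upper-triangular lattice has index ∏ |P i i| = |det P| in ℤ^r,
-- and |det P| = |det A_ρ| ≤ r! k^r by Laplace expansion.

open import Defs

module IndexBound where
  open import Data.Nat as ℕ using (ℕ; zero; suc; _!; _^_; z≤n; s≤s)
  import Data.Nat.Properties as ℕ
  import Data.Nat.Tactic.RingSolver as ℕ-Solver
  open import Data.Integer as ℤ using (ℤ; +_; 0ℤ; 1ℤ; -1ℤ; _+_; _-_; _*_; -_; ∣_∣; _/_; _%_; NonZero)
  import Data.Integer.Properties as ℤ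
  open import Data.Integer.DivMod using (n%d<d; a≡a%n+[a/n]*n)
  open import Data.Integer.Tactic.RingSolver using (solve-∀)
  open import Data.Fin using (Fin; zero; suc; toℕ; fromℕ<; punchIn; punchOut; combine; _≟_)
  open import Data.Fin.Properties
    using (suc-injective; punchInᵢ≢i; punchIn-punchOut; punchOut-punchIn; punchOut-cong; pigeonhole;
           toℕ<n; toℕ-fromℕ<; ¬∀⟶∃¬; combine-injective; injective⇒≤)
  open import Data.Vec.Functional as Vector using (updateAt)
  open import Data.Vec.Functional.Properties using (updateAt-updates; updateAt-minimal)
  open import Data.List using (List; []; _∷_; foldl; map; _++_)
  open import Data.List.Properties using (foldl-++)
  open import Data.Product as Product using (∃; _×_; _,_; proj₁; proj₂)
  open import Data.Sum as Sum using (_⊎_; inj₁; inj₂)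
  open import Data.Empty using (⊥-elim)
  open import Function using (_∘_; id)
  open import Relation.Nullary using (¬_; yes; no)
  open import Relation.Binary.Definitions using (Reflexive; Transitive)
  open import Relation.Binary.PropositionalEquality
    using (_≡_; _≢_; refl; sym; trans; cong; cong₂; cong-app; subst; module ≡-Reasoning)
  open ≡-Reasoning

  variable
    m n d r : ℕ

  infixl 21 _⊝_
  infixr 22 _·_

  _·_ : ℤ → ℤ^ n → ℤ^ n
  (q · x) j = q * x j

  _⊝_ : ℤ^ n → ℤ^ n → ℤ^ n
  x ⊝ y = x ⊕ (⊖ y)

  lincomb-cong : {a b : ℤ^ m} {v w : Fin m → ℤ^ n} → a ≈ b → (∀ i → v i ≈ w i) → lincomb a v ≈ lincomb b w
  lincomb-cong {zero}  a≈b v≈w j = refl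
  lincomb-cong {suc m} a≈b v≈w j =
    cong₂ _+_ (cong₂ _*_ (a≈b zero) (v≈w zero j)) (lincomb-cong (a≈b ∘ suc) (v≈w ∘ suc) j)

  lincomb-𝟎 : (v : Fin m → ℤ^ n) → lincomb 𝟎 v ≈ 𝟎
  lincomb-𝟎 {zero}  v j = refl
  lincomb-𝟎 {suc m} v j = cong (_+_ (0ℤ * v zero j)) (lincomb-𝟎 (v ∘ suc) j)

  lincomb-⊕ : (a b : ℤ^ m) (v : Fin m → ℤ^ n) → lincomb (a ⊕ b) v ≈ (lincomb a v ⊕ lincomb b v)
  lincomb-⊕ {zero}  a b v j = refl
  lincomb-⊕ {suc m} a b v j = trans (cong (_+_ ((a zero + b zero) * v zero j)) (lincomb-⊕ (a ∘ suc) (b ∘ suc) (v ∘ suc) j))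
    (regroup (a zero) (b zero) (v zero j) _ _)
    where
    regroup : ∀ a b w p q → (a + b) * w + (p + q) ≡ (a * w + p) + (b * w + q)
    regroup = solve-∀

  lincomb-· : ∀ q (a : ℤ^ m) (v : Fin m → ℤ^ n) → lincomb (q · a) v ≈ q · lincomb a v
  lincomb-· {zero}  q a v j = sym (ℤ.*-zeroʳ q)
  lincomb-· {suc m} q a v j = trans (cong (_+_ (q * a zero * v zero j)) (lincomb-· q (a ∘ suc) (v ∘ suc) j))
    (factor q (a zero) (v zero j) _)
    where
    factor : ∀ q a w p → q * a * w + q * p ≡ q * (a * w + p)
    factor = solve-∀

  lincomb-⊖ : (a : ℤ^ m) (v : Fin m → ℤ^ n) → lincomb (⊖ a) v ≈ (⊖ lincomb a v)
  lincomb-⊖ {zero}  a v j = refl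
  lincomb-⊖ {suc m} a v j = trans (cong (_+_ (- a zero * v zero j)) (lincomb-⊖ (a ∘ suc) (v ∘ suc) j))
    (negate (a zero) (v zero j) _)
    where
    negate : ∀ a w p → - a * w + - p ≡ - (a * w + p)
    negate = solve-∀

  lincomb-⊝ : (a b : ℤ^ m) (v : Fin m → ℤ^ n) → lincomb (a ⊝ b) v ≈ lincomb a v ⊝ lincomb b v
  lincomb-⊝ a b v j = trans (lincomb-⊕ a (⊖ b) v j) (cong (_+_ (lincomb a v j)) (lincomb-⊖ b v j))

  lincomb-∘ : (c : ℤ^ m) (v : Fin m → ℤ^ n) (f : Fin d → Fin n) → (lincomb c v ∘ f) ≈ lincomb c (λ i → v i ∘ f)
  lincomb-∘ {zero}  c v f j = refl
  lincomb-∘ {suc m} c v f j = cong (_+_ (c zero * v zero (f j))) (lincomb-∘ (c ∘ suc) (v ∘ suc) f j)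

  lincomb-vanishes : ∀ (c : ℤ^ m) (v : Fin m → ℤ^ n) j → (∀ i → v i j ≡ 0ℤ) → lincomb c v j ≡ 0ℤ
  lincomb-vanishes {zero}  c v j v≡0 = refl
  lincomb-vanishes {suc m} c v j v≡0 =
    trans (cong₂ (λ x y → c zero * x + y) (v≡0 zero) (lincomb-vanishes (c ∘ suc) (v ∘ suc) j (v≡0 ∘ suc)))
          (trans (ℤ.+-identityʳ _) (ℤ.*-zeroʳ (c zero)))

  lincomb-assoc : (c : ℤ^ r) (A : Fin r → ℤ^ d) (e : Fin d → ℤ^ n) →
    lincomb c (λ i → lincomb (A i) e) ≈ lincomb (lincomb c A) e
  lincomb-assoc {zero}  c A e j = sym (lincomb-𝟎 e j)
  lincomb-assoc {suc r} c A e j = begin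
    c zero * lincomb (A zero) e j + lincomb (c ∘ suc) (λ i → lincomb (A (suc i)) e) j
      ≡⟨ cong₂ _+_ (sym (lincomb-· (c zero) (A zero) e j)) (lincomb-assoc (c ∘ suc) (A ∘ suc) e j) ⟩
    lincomb (c zero · A zero) e j + lincomb (lincomb (c ∘ suc) (A ∘ suc)) e j
      ≡⟨ sym (lincomb-⊕ (c zero · A zero) _ e j) ⟩
    lincomb (lincomb c A) e j ∎

  lincomb-injective : {v : Fin m → ℤ^ n} → LinearlyIndependent v →
    {a b : ℤ^ m} → lincomb a v ≈ lincomb b v → a ≈ b
  lincomb-injective {v = v} independent {a} {b} a·v≈b·v i =
    ℤ.i-j≡0⇒i≡j _ _ (independent (a ⊝ b) difference≈𝟎 i)
    where
    difference≈𝟎 : lincomb (a ⊝ b) v ≈ 𝟎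
    difference≈𝟎 j = trans (lincomb-⊝ a b v j)
      (trans (cong (_- lincomb b v j) (a·v≈b·v j)) (ℤ.+-inverseʳ (lincomb b v j)))

  independent-tail : {v : Fin (suc m) → ℤ^ n} → LinearlyIndependent v → LinearlyIndependent (v ∘ suc)
  independent-tail {v = v} independent c c·v≈𝟎 i =
    independent (0ℤ Vector.∷ c) (λ j → cong (_+_ (0ℤ * v zero j)) (c·v≈𝟎 j)) (suc i)

  independent⇒head≉𝟎 : {v : Fin (suc m) → ℤ^ n} → LinearlyIndependent v → ¬ (v zero ≈ 𝟎)
  independent⇒head≉𝟎 {v = v} independent v₀≈𝟎 = 1≢0 (independent (1ℤ Vector.∷ 𝟎) unit·v≈𝟎 zero)
    where
    1≢0 : 1ℤ ≢ 0ℤ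
    1≢0 ()
    unit·v≈𝟎 : lincomb (1ℤ Vector.∷ 𝟎) v ≈ 𝟎
    unit·v≈𝟎 j = trans (cong₂ _+_ (ℤ.*-identityˡ (v zero j)) (lincomb-𝟎 (v ∘ suc) j))
      (trans (ℤ.+-identityʳ (v zero j)) (v₀≈𝟎 j))

  InSpan-resp : {v : Fin m → ℤ^ n} {x y : ℤ^ n} → x ≈ y → InSpan v x → InSpan v y
  InSpan-resp x≈y (a , a·v≈x) = a , λ j → trans (a·v≈x j) (x≈y j)

  InSpan-⊕ : {v : Fin m → ℤ^ n} {x y : ℤ^ n} → InSpan v x → InSpan v y → InSpan v (x ⊕ y)
  InSpan-⊕ {v = v} (a , a·v≈x) (b , b·v≈y) =
    a ⊕ b , λ j → trans (lincomb-⊕ a b v j) (cong₂ _+_ (a·v≈x j) (b·v≈y j))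

  InSpan-⊖ : {v : Fin m → ℤ^ n} {x : ℤ^ n} → InSpan v x → InSpan v (⊖ x)
  InSpan-⊖ {v = v} (a , a·v≈x) = ⊖ a , λ j → trans (lincomb-⊖ a v j) (cong -_ (a·v≈x j))

  module _ {Z : ℤ^ n → Set} (Z-subgroup : IsSubgroup Z) where
    open IsSubgroup Z-subgroup

    ·-mem : ∀ N {u} → Z u → Z ((+ N) · u)
    ·-mem zero    {u} Zu = resp (λ j → sym (ℤ.*-zeroˡ (u j))) zero-mem
    ·-mem (suc N) {u} Zu = resp (λ j → sym (ℤ.suc-* (+ N) (u j))) (add-mem Zu (·-mem N Zu))

    -- Two of the m + 1 multiples 0·u, …, m·u lie in the same coset.
    nonzero-multiple-in-span : {s : Fin r → ℤ^ n} {t : Fin m → ℤ^ n} →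
      (∀ z → Z z → ∃ λ i → InSpan s (z ⊝ t i)) →
      ∀ {u} → Z u → ∃ λ N → N ≢ 0ℤ × InSpan s (N · u)
    nonzero-multiple-in-span {m = m} {s = s} {t} cosets {u} Zu =
      let a , b , a<b , same-coset = pigeonhole (ℕ.n<1+n m) coset-of-multiple
          a·u∈b-coset = subst (λ i → InSpan s ((+ toℕ a) · u ⊝ t i)) same-coset (in-coset a)
      in + toℕ b - + toℕ a , ℕ.<⇒≢ a<b ∘ sym ∘ ℤ.+-injective ∘ ℤ.i-j≡0⇒i≡j _ _ ,
         InSpan-resp (difference-of-multiples b a) (InSpan-⊕ (in-coset b) (InSpan-⊖ a·u∈b-coset))
      where
      coset-of-multiple : Fin (suc m) → Fin m
      coset-of-multiple a = proj₁ (cosets ((+ toℕ a) · u) (·-mem (toℕ a) Zu))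
      in-coset : ∀ a → InSpan s ((+ toℕ a) · u ⊝ t (coset-of-multiple a))
      in-coset a = proj₂ (cosets ((+ toℕ a) · u) (·-mem (toℕ a) Zu))
      difference-of-multiples : ∀ b a {x} → ((+ toℕ b) · u ⊝ x) ⊝ ((+ toℕ a) · u ⊝ x) ≈ (+ toℕ b - + toℕ a) · u
      difference-of-multiples b a {x} j = cancel (+ toℕ b) (+ toℕ a) (u j) (x j)
        where
        cancel : ∀ B A U T → (B * U + - T) + - (A * U + - T) ≡ (B - A) * U
        cancel = solve-∀

  -- Determinants

  Mat : ℕ → Set
  Mat n = Fin n → ℤ^ n

  altSum : ℤ^ n → ℤ
  altSum {zero}  f = 0ℤ
  altSum {suc n} f = f zero - altSum (f ∘ suc)

  minor : Fin (suc n) → Mat (suc n) → Mat n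
  minor i M a b = M (punchIn i a) (suc b)

  det : Mat n → ℤ
  det {zero}  M = 1ℤ
  det {suc n} M = altSum (λ i → M i zero * det (minor i M))

  altSum-cong : {f g : ℤ^ n} → f ≈ g → altSum f ≡ altSum g
  altSum-cong {zero}  f≈g = refl
  altSum-cong {suc n} f≈g = cong₂ _-_ (f≈g zero) (altSum-cong (f≈g ∘ suc))

  altSum-𝟎 : {f : ℤ^ n} → f ≈ 𝟎 → altSum f ≡ 0ℤ
  altSum-𝟎 {zero}  f≈𝟎 = refl
  altSum-𝟎 {suc n} f≈𝟎 = cong₂ _-_ (f≈𝟎 zero) (altSum-𝟎 (f≈𝟎 ∘ suc))

  altSum-linear : ∀ q {f g h : ℤ^ n} → f ≈ (g ⊕ q · h) → altSum f ≡ altSum g + q * altSum h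
  altSum-linear {zero}  q f≈ = sym (trans (ℤ.+-identityˡ (q * 0ℤ)) (ℤ.*-zeroʳ q))
  altSum-linear {suc n} q {f} {g} {h} f≈ =
    trans (cong₂ _-_ (f≈ zero) (altSum-linear q (f≈ ∘ suc)))
          (regroup (g zero) (h zero) (altSum (g ∘ suc)) (altSum (h ∘ suc)) q)
    where
    regroup : ∀ a b c d q → (a + q * b) - (c + q * d) ≡ (a - c) + q * (b - d)
    regroup = solve-∀

  det-cong : {M N : Mat n} → (∀ i → M i ≈ N i) → det M ≡ det N
  det-cong {zero}  M≈N = refl
  det-cong {suc n} M≈N = altSum-cong λ i →
    cong₂ _*_ (M≈N i zero) (det-cong (λ a b → M≈N (punchIn i a) (suc b)))

  punchIn≡⇒≡punchOut : ∀ {i a : Fin (suc n)} (i≢a : i ≢ a) {l} → punchIn i l ≡ a → l ≡ punchOut i≢a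
  punchIn≡⇒≡punchOut {i = i} i≢a eq = trans (sym (punchOut-punchIn i)) (punchOut-cong i eq)

  det-linear : ∀ (a : Fin n) q {P Q R : Mat n} →
    (∀ i → i ≢ a → P i ≈ Q i) → (∀ i → i ≢ a → R i ≈ Q i) → P a ≈ (Q a ⊕ q · R a) →
    det P ≡ det Q + q * det R
  det-linear {suc n} a q {P} {Q} {R} P≈Q R≈Q Pa≈ =
    altSum-linear q {g = λ i → Q i zero * det (minor i Q)} {h = λ i → R i zero * det (minor i R)} expansion-term
    where
    expansion-term : ∀ i → P i zero * det (minor i P) ≡ Q i zero * det (minor i Q) + q * (R i zero * det (minor i R))
    expansion-term i with i ≟ a
    ... | yes refl = begin
      P i zero * det (minor i P)                    ≡⟨ cong₂ _*_ (Pa≈ zero) (det-cong (off-row P≈Q)) ⟩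
      (Q i zero + q * R i zero) * det (minor i Q)   ≡⟨ distrib (Q i zero) (R i zero) q _ ⟩
      Q i zero * det (minor i Q) + q * (R i zero * det (minor i Q))
        ≡⟨ cong (λ x → Q i zero * det (minor i Q) + q * (R i zero * x)) (sym (det-cong (off-row R≈Q))) ⟩
      Q i zero * det (minor i Q) + q * (R i zero * det (minor i R)) ∎
      where
      off-row : ∀ {S : Mat (suc n)} → (∀ j → j ≢ i → S j ≈ Q j) → ∀ l → minor i S l ≈ minor i Q l
      off-row S≈Q l b = S≈Q (punchIn i l) (punchInᵢ≢i i l) (suc b)
      distrib : ∀ x y q d → (x + q * y) * d ≡ x * d + q * (y * d)
      distrib = solve-∀
    ... | no i≢a = begin
      P i zero * det (minor i P)                                  ≡⟨ cong₂ _*_ (P≈Q i i≢a zero) minor-linear ⟩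
      Q i zero * (det (minor i Q) + q * det (minor i R))          ≡⟨ distrib (Q i zero) q _ _ ⟩
      Q i zero * det (minor i Q) + q * (Q i zero * det (minor i R))
        ≡⟨ cong (λ x → Q i zero * det (minor i Q) + q * (x * det (minor i R))) (sym (R≈Q i i≢a zero)) ⟩
      Q i zero * det (minor i Q) + q * (R i zero * det (minor i R)) ∎
      where
      off-row : ∀ {S : Mat (suc n)} → (∀ j → j ≢ a → S j ≈ Q j) →
                ∀ l → l ≢ punchOut i≢a → minor i S l ≈ minor i Q l
      off-row S≈Q l l≢a b = S≈Q (punchIn i l) (l≢a ∘ punchIn≡⇒≡punchOut i≢a) (suc b)
      minor-linear : det (minor i P) ≡ det (minor i Q) + q * det (minor i R)
      minor-linear = det-linear (punchOut i≢a) q (off-row P≈Q) (off-row R≈Q)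
        (λ b → subst (λ j → P j (suc b) ≡ Q j (suc b) + q * R j (suc b)) (sym (punchIn-punchOut i≢a)) (Pa≈ (suc b)))
      distrib : ∀ x q d e → x * (d + q * e) ≡ x * d + q * (x * e)
      distrib = solve-∀

  altSum-adjacent-cancel : ∀ {f : ℤ^ n} (p q : Fin n) → toℕ q ≡ suc (toℕ p) → f p ≡ f q →
    (∀ i → i ≢ p → i ≢ q → f i ≡ 0ℤ) → altSum f ≡ 0ℤ
  altSum-adjacent-cancel zero zero ()
  altSum-adjacent-cancel (suc p) zero ()
  altSum-adjacent-cancel zero (suc (suc q)) ()
  altSum-adjacent-cancel {f = f} zero (suc zero) _ f₀≡f₁ f≡0 = begin
    f zero - (f (suc zero) - altSum (λ i → f (suc (suc i))))
      ≡⟨ cong₂ (λ x y → f zero - (x - y)) (sym f₀≡f₁) (altSum-𝟎 {f = λ i → f (suc (suc i))} tail≡0) ⟩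
    f zero - (f zero - 0ℤ) ≡⟨ cancel (f zero) ⟩
    0ℤ ∎
    where
    tail≡0 : (λ i → f (suc (suc i))) ≈ 𝟎
    tail≡0 i = f≡0 (suc (suc i)) (λ ()) (λ ())
    cancel : ∀ x → x - (x - 0ℤ) ≡ 0ℤ
    cancel = solve-∀
  altSum-adjacent-cancel {f = f} (suc p) (suc q) q≡1+p fp≡fq f≡0 =
    cong₂ _-_ (f≡0 zero (λ ()) (λ ()))
      (altSum-adjacent-cancel p q (ℕ.suc-injective q≡1+p) fp≡fq
        (λ i i≢p i≢q → f≡0 (suc i) (i≢p ∘ suc-injective) (i≢q ∘ suc-injective)))

  punchIn-adjacent : ∀ (p q : Fin (suc n)) → toℕ q ≡ suc (toℕ p) → ∀ l →
    punchIn p l ≡ punchIn q l ⊎ (punchIn p l ≡ q × punchIn q l ≡ p)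
  punchIn-adjacent zero (suc zero) _ zero = inj₂ (refl , refl)
  punchIn-adjacent zero (suc zero) _ (suc l) = inj₁ refl
  punchIn-adjacent zero (suc (suc q)) ()
  punchIn-adjacent (suc p) (suc q) _ zero = inj₁ refl
  punchIn-adjacent (suc p) (suc q) q≡1+p (suc l) =
    Sum.map (cong suc) (Product.map (cong suc) (cong suc)) (punchIn-adjacent p q (ℕ.suc-injective q≡1+p) l)

  punchOut-adjacent : ∀ {i p q : Fin (suc n)} (i≢p : i ≢ p) (i≢q : i ≢ q) → toℕ q ≡ suc (toℕ p) →
    toℕ (punchOut i≢q) ≡ suc (toℕ (punchOut i≢p))
  punchOut-adjacent {i = zero} {zero} i≢p _ _ = ⊥-elim (i≢p refl)
  punchOut-adjacent {i = zero} {suc p} {zero} _ _ ()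
  punchOut-adjacent {i = zero} {suc p} {suc q} _ _ q≡1+p = ℕ.suc-injective q≡1+p
  punchOut-adjacent {suc n} {suc i} {zero} {zero} _ _ ()
  punchOut-adjacent {suc n} {suc zero} {zero} {suc zero} _ i≢q _ = ⊥-elim (i≢q refl)
  punchOut-adjacent {suc (suc n)} {suc (suc i)} {zero} {suc zero} _ _ _ = refl
  punchOut-adjacent {suc n} {suc i} {zero} {suc (suc q)} _ _ ()
  punchOut-adjacent {suc n} {suc i} {suc p} {zero} _ _ ()
  punchOut-adjacent {suc n} {suc i} {suc p} {suc q} i≢p i≢q q≡1+p =
    cong suc (punchOut-adjacent (i≢p ∘ cong suc) (i≢q ∘ cong suc) (ℕ.suc-injective q≡1+p))

  adjacentRows⇒det≡0 : ∀ {M : Mat n} (p q : Fin n) → toℕ q ≡ suc (toℕ p) → M p ≈ M q → det M ≡ 0ℤ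
  adjacentRows⇒det≡0 {suc n} {M} p q q≡1+p Mp≈Mq =
    altSum-adjacent-cancel p q q≡1+p (cong₂ _*_ (Mp≈Mq zero) (det-cong minors-equal)) other-terms-vanish
    where
    row : ∀ {i j} → i ≡ j → ∀ b → M i (suc b) ≡ M j (suc b)
    row i≡j b = cong (λ i → M i (suc b)) i≡j
    minors-equal : ∀ l → minor p M l ≈ minor q M l
    minors-equal l b with punchIn-adjacent p q q≡1+p l
    ... | inj₁ eq = row eq b
    ... | inj₂ (eq₁ , eq₂) = trans (row eq₁ b) (trans (sym (Mp≈Mq (suc b))) (row (sym eq₂) b))
    other-terms-vanish : ∀ i → i ≢ p → i ≢ q → M i zero * det (minor i M) ≡ 0ℤ
    other-terms-vanish i i≢p i≢q = trans (cong (M i zero *_) minor-vanishes) (ℤ.*-zeroʳ (M i zero))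
      where
      minor-vanishes : det (minor i M) ≡ 0ℤ
      minor-vanishes = adjacentRows⇒det≡0 (punchOut i≢p) (punchOut i≢q) (punchOut-adjacent i≢p i≢q q≡1+p)
        (λ b → trans (row (punchIn-punchOut i≢p) b) (trans (Mp≈Mq (suc b)) (row (sym (punchIn-punchOut i≢q)) b)))

  lowerRight : Mat (suc n) → Mat n
  lowerRight M i j = M (suc i) (suc j)

  UpperTriangular : Mat n → Set
  UpperTriangular M = ∀ i j → toℕ j ℕ.< toℕ i → M i j ≡ 0ℤ

  ∏∣diag∣ : Mat n → ℕ
  ∏∣diag∣ {zero}  M = 1
  ∏∣diag∣ {suc n} M = ∣ M zero zero ∣ ℕ.* ∏∣diag∣ (lowerRight M)

  ∣det∣≡∏∣diag∣ : {M : Mat n} → UpperTriangular M → ∣ det M ∣ ≡ ∏∣diag∣ M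
  ∣det∣≡∏∣diag∣ {zero}      _       = refl
  ∣det∣≡∏∣diag∣ {suc n} {M} M-upper = begin
    ∣ M zero zero * det (lowerRight M) - altSum (λ i → M (suc i) zero * det (minor (suc i) M)) ∣
      ≡⟨ cong (λ x → ∣ M zero zero * det (lowerRight M) - x ∣) (altSum-𝟎 below-diagonal) ⟩
    ∣ M zero zero * det (lowerRight M) - 0ℤ ∣       ≡⟨ cong ∣_∣ (ℤ.+-identityʳ (M zero zero * det (lowerRight M))) ⟩
    ∣ M zero zero * det (lowerRight M) ∣            ≡⟨ ℤ.abs-* (M zero zero) _ ⟩
    ∣ M zero zero ∣ ℕ.* ∣ det (lowerRight M) ∣
      ≡⟨ cong (∣ M zero zero ∣ ℕ.*_) (∣det∣≡∏∣diag∣ lowerRight-upper) ⟩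
    ∏∣diag∣ M ∎
    where
    below-diagonal : (λ i → M (suc i) zero * det (minor (suc i) M)) ≈ 𝟎
    below-diagonal i = cong (_* det (minor (suc i) M)) (M-upper (suc i) zero (s≤s z≤n))
    lowerRight-upper : UpperTriangular (lowerRight M)
    lowerRight-upper i j j<i = M-upper (suc i) (suc j) (s≤s j<i)

  ∣altSum∣≤ : ∀ B {f : ℤ^ n} → (∀ i → ∣ f i ∣ ℕ.≤ B) → ∣ altSum f ∣ ℕ.≤ n ℕ.* B
  ∣altSum∣≤ {zero}  B f≤B = z≤n
  ∣altSum∣≤ {suc n} B {f} f≤B =
    ℕ.≤-trans (ℤ.∣i-j∣≤∣i∣+∣j∣ (f zero) (altSum (f ∘ suc)))
              (ℕ.+-mono-≤ (f≤B zero) (∣altSum∣≤ B (f≤B ∘ suc)))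

  ∣det∣≤n!*k^n : ∀ k {M : Mat n} → (∀ i j → ∣ M i j ∣ ℕ.≤ k) → ∣ det M ∣ ℕ.≤ n ! ℕ.* k ^ n
  ∣det∣≤n!*k^n {zero}  k M≤k = ℕ.≤-refl
  ∣det∣≤n!*k^n {suc n} k {M} M≤k =
    ℕ.≤-trans (∣altSum∣≤ (k ℕ.* (n ! ℕ.* k ^ n)) {λ i → M i zero * det (minor i M)} term≤)
              (ℕ.≤-reflexive (rearrange (suc n) k (n !) (k ^ n)))
    where
    term≤ : ∀ i → ∣ M i zero * det (minor i M) ∣ ℕ.≤ k ℕ.* (n ! ℕ.* k ^ n)
    term≤ i = ℕ.≤-trans (ℕ.≤-reflexive (ℤ.abs-* (M i zero) (det (minor i M))))
      (ℕ.*-mono-≤ (M≤k i zero) (∣det∣≤n!*k^n k {minor i M} (λ a b → M≤k (punchIn i a) (suc b))))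
    rearrange : ∀ a k b c → a ℕ.* (k ℕ.* (b ℕ.* c)) ≡ a ℕ.* b ℕ.* (k ℕ.* c)
    rearrange = ℕ-Solver.solve-∀

  -- Row operations between adjacent rows

  -- Restricting to adjacent rows means that invariance of the minors only needs det to vanish on
  -- matrices with two equal adjacent rows.
  record RowOp (r : ℕ) : Set where
    constructor rowOp
    field
      target source : Fin r
      adjacent : toℕ source ≡ suc (toℕ target) ⊎ toℕ target ≡ suc (toℕ source)
      factor : ℤ

  applyOp : RowOp r → (Fin r → ℤ^ d) → (Fin r → ℤ^ d)
  applyOp (rowOp t s _ f) A = updateAt A t (λ x → x ⊕ f · A s)

  source≢target : (o : RowOp r) → RowOp.source o ≢ RowOp.target o
  source≢target (rowOp t s (inj₁ s≡1+t) f) s≡t = ℕ.1+n≢n (trans (sym s≡1+t) (cong toℕ s≡t))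
  source≢target (rowOp t s (inj₂ t≡1+s) f) s≡t = ℕ.1+n≢n (trans (sym t≡1+s) (cong toℕ (sym s≡t)))

  selectColumns : (Fin r → Fin d) → (Fin r → ℤ^ d) → Mat r
  selectColumns ρ A i = A i ∘ ρ

  det-applyOp : ∀ (o : RowOp r) (ρ : Fin r → Fin d) A → det (selectColumns ρ (applyOp o A)) ≡ det (selectColumns ρ A)
  det-applyOp o@(rowOp t s adjacent f) ρ A = begin
    det (selectColumns ρ (applyOp o A))                        ≡⟨ det-linear t f off-target off-target on-target ⟩
    det (selectColumns ρ A) + f * det (selectColumns ρ copy)   ≡⟨ cong (λ x → det (selectColumns ρ A) + f * x) copy-singular ⟩
    det (selectColumns ρ A) + f * 0ℤ                           ≡⟨ cong (_+_ (det (selectColumns ρ A))) (ℤ.*-zeroʳ f) ⟩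
    det (selectColumns ρ A) + 0ℤ                               ≡⟨ ℤ.+-identityʳ _ ⟩
    det (selectColumns ρ A)                                    ∎
    where
    copy : Fin _ → ℤ^ _
    copy = updateAt A t (λ _ → A s)
    off-target : ∀ {g} i → i ≢ t → selectColumns ρ (updateAt A t g) i ≈ selectColumns ρ A i
    off-target i i≢t b = cong-app (updateAt-minimal i t A i≢t) (ρ b)
    on-target : selectColumns ρ (applyOp o A) t ≈ (selectColumns ρ A t ⊕ f · selectColumns ρ copy t)
    on-target b = trans (cong-app (updateAt-updates t A) (ρ b))
      (cong (λ x → A t (ρ b) + f * x (ρ b)) (sym (updateAt-updates t A)))
    rows-equal : selectColumns ρ copy t ≈ selectColumns ρ copy s
    rows-equal b = cong-app (trans (updateAt-updates t A) (sym (updateAt-minimal s t A (source≢target o)))) (ρ b)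
    copy-singular : det (selectColumns ρ copy) ≡ 0ℤ
    copy-singular = Sum.[ (λ s≡1+t → adjacentRows⇒det≡0 {M = M} t s s≡1+t rows-equal)
                        , (λ t≡1+s → adjacentRows⇒det≡0 {M = M} s t t≡1+s (sym ∘ rows-equal)) ]′ adjacent
      where M = selectColumns ρ copy

  lincomb-updateAt-⊕ : ∀ (k : ℤ^ r) (A : Fin r → ℤ^ d) i w →
    lincomb k (updateAt A i (λ x → x ⊕ w)) ≈ (lincomb k A ⊕ k i · w)
  lincomb-updateAt-⊕ k A zero w j = distrib (k zero) (A zero j) (w j) _
    where
    distrib : ∀ k a w p → k * (a + w) + p ≡ (k * a + p) + k * w
    distrib = solve-∀
  lincomb-updateAt-⊕ k A (suc i) w j =
    trans (cong (_+_ (k zero * A zero j)) (lincomb-updateAt-⊕ (k ∘ suc) (A ∘ suc) i w j))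
          (sym (ℤ.+-assoc (k zero * A zero j) (lincomb (k ∘ suc) (A ∘ suc) j) (k (suc i) * w j)))

  lincomb-updateAt-+ : ∀ (k : ℤ^ r) (A : Fin r → ℤ^ d) i a →
    lincomb (updateAt k i (λ x → x + a)) A ≈ (lincomb k A ⊕ a · A i)
  lincomb-updateAt-+ k A zero a j = distrib (k zero) a (A zero j) _
    where
    distrib : ∀ k a x p → (k + a) * x + p ≡ (k * x + p) + a * x
    distrib = solve-∀
  lincomb-updateAt-+ k A (suc i) a j =
    trans (cong (_+_ (k zero * A zero j)) (lincomb-updateAt-+ (k ∘ suc) (A ∘ suc) i a j))
          (sym (ℤ.+-assoc (k zero * A zero j) (lincomb (k ∘ suc) (A ∘ suc) j) (a * A (suc i) j)))

  pullback : RowOp r → ℤ^ r → ℤ^ r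
  pullback (rowOp t s _ f) k = updateAt k s (λ x → x + k t * f)

  lincomb-applyOp : ∀ (o : RowOp r) k (A : Fin r → ℤ^ d) → lincomb k (applyOp o A) ≈ lincomb (pullback o k) A
  lincomb-applyOp (rowOp t s _ f) k A j = begin
    lincomb k (updateAt A t (λ x → x ⊕ f · A s)) j ≡⟨ lincomb-updateAt-⊕ k A t (f · A s) j ⟩
    lincomb k A j + k t * (f * A s j)             ≡⟨ cong (_+_ (lincomb k A j)) (sym (ℤ.*-assoc (k t) f (A s j))) ⟩
    lincomb k A j + k t * f * A s j               ≡⟨ lincomb-updateAt-+ k A s (k t * f) j ⟨
    lincomb (updateAt k s (λ x → x + k t * f)) A j ∎

  negateOp : RowOp r → RowOp r
  negateOp (rowOp t s adjacent f) = rowOp t s adjacent (- f)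

  applyOp-negateOp : ∀ (o : RowOp r) (A : Fin r → ℤ^ d) i → applyOp (negateOp o) (applyOp o A) i ≈ A i
  applyOp-negateOp o@(rowOp t s _ f) A i j with i ≟ t
  ... | yes refl = begin
    updateAt B i (λ x → x ⊕ (- f) · B s) i j ≡⟨ cong-app (updateAt-updates i B) j ⟩
    B i j + - f * B s j
      ≡⟨ cong₂ (λ x y → x j + - f * y j) (updateAt-updates i A) (updateAt-minimal s i A (source≢target o)) ⟩
    (A i j + f * A s j) + - f * A s j     ≡⟨ cancel (A i j) f (A s j) ⟩
    A i j                                  ∎
    where
    B = applyOp o A
    cancel : ∀ a f b → (a + f * b) + - f * b ≡ a
    cancel = solve-∀
  ... | no i≢t = cong-app (trans (updateAt-minimal i t _ i≢t) (updateAt-minimal i t A i≢t)) j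

  InSpan-applyOp⁻ : ∀ (o : RowOp r) {A : Fin r → ℤ^ d} {x} → InSpan (applyOp o A) x → InSpan A x
  InSpan-applyOp⁻ o {A} (k , k·oA≈x) = pullback o k , λ j → trans (sym (lincomb-applyOp o k A j)) (k·oA≈x j)

  InSpan-applyOp : ∀ (o : RowOp r) {A : Fin r → ℤ^ d} {x} → InSpan A x → InSpan (applyOp o A) x
  InSpan-applyOp o {A} (k , k·A≈x) =
    InSpan-applyOp⁻ (negateOp o) (k , λ j → trans (lincomb-cong (λ _ → refl) (applyOp-negateOp o A) j) (k·A≈x j))

  applyOp-independent : ∀ (o : RowOp r) {A : Fin r → ℤ^ d} → LinearlyIndependent A → LinearlyIndependent (applyOp o A)
  applyOp-independent o@(rowOp t s _ f) {A} independent k k·oA≈𝟎 i with i ≟ s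
  ... | yes refl = begin
    k i               ≡⟨ ℤ.+-identityʳ (k i) ⟨
    k i + 0ℤ          ≡⟨ cong (λ x → k i + x * f) kt≡0 ⟨
    k i + k t * f     ≡⟨ updateAt-updates i k ⟨
    pullback o k i    ≡⟨ pullback≈𝟎 i ⟩
    0ℤ                ∎
    where
    pullback≈𝟎 : pullback o k ≈ 𝟎
    pullback≈𝟎 = independent (pullback o k) (λ j → trans (sym (lincomb-applyOp o k A j)) (k·oA≈𝟎 j))
    kt≡0 : k t ≡ 0ℤ
    kt≡0 = trans (sym (updateAt-minimal t i k (source≢target o ∘ sym))) (pullback≈𝟎 t)
  ... | no i≢s = trans (sym (updateAt-minimal i s k i≢s))
    (independent (pullback o k) (λ j → trans (sym (lincomb-applyOp o k A j)) (k·oA≈𝟎 j)) i)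

  applyOp-zero-column : ∀ (o : RowOp r) {A : Fin r → ℤ^ d} p → (∀ i → A i p ≡ 0ℤ) → ∀ i → applyOp o A i p ≡ 0ℤ
  applyOp-zero-column (rowOp t s _ f) {A} p A≡0 i with i ≟ t
  ... | yes refl = trans (cong-app (updateAt-updates i A) p)
    (trans (cong₂ (λ x y → x + f * y) (A≡0 i) (A≡0 s)) (trans (ℤ.+-identityˡ _) (ℤ.*-zeroʳ f)))
  ... | no i≢t = trans (cong-app (updateAt-minimal i t A i≢t) p) (A≡0 i)

  applyOps : List (RowOp r) → (Fin r → ℤ^ d) → (Fin r → ℤ^ d)
  applyOps os A = foldl (λ B o → applyOp o B) A os

  infix 4 _↝_
  _↝_ : (Fin r → ℤ^ d) → (Fin r → ℤ^ d) → Set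
  A ↝ B = ∃ λ os → applyOps os A ≡ B

  ↝-refl : {A : Fin r → ℤ^ d} → A ↝ A
  ↝-refl = [] , refl

  ↝-trans : {A B C : Fin r → ℤ^ d} → A ↝ B → B ↝ C → A ↝ C
  ↝-trans {A = A} (os , refl) (ps , refl) = os ++ ps , foldl-++ (λ B o → applyOp o B) A os ps

  ↝-induction : (R : (Fin r → ℤ^ d) → (Fin r → ℤ^ d) → Set) → Reflexive R → Transitive R →
    (∀ o A → R A (applyOp o A)) → ∀ {A B} → A ↝ B → R A B
  ↝-induction R R-refl R-trans R-step (os , refl) = along os _
    where
    along : ∀ os A → R A (applyOps os A)
    along []       A = R-refl
    along (o ∷ os) A = R-trans (R-step o A) (along os (applyOp o A))

  ↝-det : ∀ (ρ : Fin r → Fin d) {A B} → A ↝ B → det (selectColumns ρ B) ≡ det (selectColumns ρ A)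
  ↝-det ρ = ↝-induction (λ A B → det (selectColumns ρ B) ≡ det (selectColumns ρ A)) refl (λ p q → trans q p)
    (λ o A → det-applyOp o ρ A)

  ↝-InSpan : {A B : Fin r → ℤ^ d} → A ↝ B → ∀ {x} → InSpan B x → InSpan A x
  ↝-InSpan = ↝-induction (λ A B → ∀ {x} → InSpan B x → InSpan A x) id (λ f g → f ∘ g) (λ o A → InSpan-applyOp⁻ o)

  ↝-InSpan⁻ : {A B : Fin r → ℤ^ d} → A ↝ B → ∀ {x} → InSpan A x → InSpan B x
  ↝-InSpan⁻ = ↝-induction (λ A B → ∀ {x} → InSpan A x → InSpan B x) id (λ f g → g ∘ f) (λ o A → InSpan-applyOp o)

  ↝-independent : {A B : Fin r → ℤ^ d} → A ↝ B → LinearlyIndependent A → LinearlyIndependent B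
  ↝-independent = ↝-induction (λ A B → LinearlyIndependent A → LinearlyIndependent B) id (λ f g → g ∘ f)
    (λ o A → applyOp-independent o)

  ↝-zero-column : ∀ p {A B : Fin r → ℤ^ d} → A ↝ B → (∀ i → A i p ≡ 0ℤ) → ∀ i → B i p ≡ 0ℤ
  ↝-zero-column p = ↝-induction (λ A B → (∀ i → A i p ≡ 0ℤ) → ∀ i → B i p ≡ 0ℤ) id (λ f g → g ∘ f)
    (λ o A → applyOp-zero-column o p)

  shiftOp : RowOp r → RowOp (suc r)
  shiftOp (rowOp t s adjacent f) = rowOp (suc t) (suc s) (Sum.map (cong suc) (cong suc) adjacent) f

  ↝-shift : {A : Fin (suc r) → ℤ^ d} {B : Fin r → ℤ^ d} → A ∘ suc ↝ B →
    ∃ λ C → A ↝ C × C zero ≡ A zero × C ∘ suc ≡ B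
  ↝-shift {A = A} (os , refl) = applyOps (map shiftOp os) A , (map shiftOp os , refl) , head-fixed os A , tail-shifted os A
    where
    head-fixed : ∀ os A → applyOps (map shiftOp os) A zero ≡ A zero
    head-fixed []                   A = refl
    head-fixed (rowOp _ _ _ _ ∷ os) A = head-fixed os _
    tail-shifted : ∀ os A → applyOps (map shiftOp os) A ∘ suc ≡ applyOps os (A ∘ suc)
    tail-shifted []                   A = refl
    tail-shifted (rowOp _ _ _ _ ∷ os) A = tail-shifted os _

  -- Euclidean reduction to echelon form

  module Division (a b : ℤ) (b≢0 : b ≢ 0ℤ) where
    private instance
      b-nonZero : NonZero b
      b-nonZero = ℤ.≢-nonZero b≢0

    quotient : ℤ
    quotient = - (a / b)

    remainder : Fin ∣ b ∣
    remainder = fromℕ< (n%d<d a b)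

    a+quotient*b≡remainder : a + quotient * b ≡ + toℕ remainder
    a+quotient*b≡remainder = begin
      a + - (a / b) * b                         ≡⟨ cong (λ x → x + - (a / b) * b) (a≡a%n+[a/n]*n a b) ⟩
      (+ (a % b) + a / b * b) + - (a / b) * b   ≡⟨ cancel (+ (a % b)) (a / b) b ⟩
      + (a % b)                                 ≡⟨ cong +_ (toℕ-fromℕ< (n%d<d a b)) ⟨
      + toℕ remainder                           ∎
      where
      cancel : ∀ r q b → (r + q * b) + - q * b ≡ r
      cancel = solve-∀

  add₁to₀ add₀to₁ : ℤ → RowOp (suc (suc r))
  add₁to₀ q = rowOp zero (suc zero) (inj₁ refl) q
  add₀to₁ q = rowOp (suc zero) zero (inj₂ refl) q

  swapOps : List (RowOp (suc (suc r)))
  swapOps = add₁to₀ 1ℤ ∷ add₀to₁ -1ℤ ∷ add₁to₀ 1ℤ ∷ []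

  applyOps-swapOps₀ : (A : Fin (suc (suc r)) → ℤ^ d) → applyOps swapOps A zero ≈ A (suc zero)
  applyOps-swapOps₀ A j = swap (A zero j) (A (suc zero) j)
    where
    swap : ∀ x y → (x + 1ℤ * y) + 1ℤ * (y + -1ℤ * (x + 1ℤ * y)) ≡ y
    swap = solve-∀

  applyOps-swapOps₁ : (A : Fin (suc (suc r)) → ℤ^ d) → applyOps swapOps A (suc zero) ≈ (⊖ A zero)
  applyOps-swapOps₁ A j = swap (A zero j) (A (suc zero) j)
    where
    swap : ∀ x y → y + -1ℤ * (x + 1ℤ * y) ≡ - x
    swap = solve-∀

  euclidStep : ∀ (A : Fin (suc (suc r)) → ℤ^ d) p → A (suc zero) p ≢ 0ℤ →
    ∃ λ B → A ↝ B × B zero p ≡ A (suc zero) p × ∣ B (suc zero) p ∣ ℕ.< ∣ A (suc zero) p ∣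
          × (∀ i → B (suc (suc i)) ≈ A (suc (suc i)))
  euclidStep A p b≢0 =
    applyOps swapOps A′ , (add₁to₀ quotient ∷ swapOps , refl) , applyOps-swapOps₀ A′ p , ∣B₁∣<∣b∣ , λ i j → refl
    where
    open Division (A zero p) (A (suc zero) p) b≢0
    A′ : Fin _ → ℤ^ _
    A′ = applyOp (add₁to₀ quotient) A
    ∣B₁∣<∣b∣ : ∣ applyOps swapOps A′ (suc zero) p ∣ ℕ.< ∣ A (suc zero) p ∣
    ∣B₁∣<∣b∣ = subst (ℕ._< ∣ A (suc zero) p ∣)
      (sym (trans (cong ∣_∣ (applyOps-swapOps₁ A′ p))
                  (trans (ℤ.∣-i∣≡∣i∣ (A′ zero p)) (cong ∣_∣ a+quotient*b≡remainder))))
      (toℕ<n remainder)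

  euclid : ∀ N (A : Fin (suc (suc r)) → ℤ^ d) p → ∣ A (suc zero) p ∣ ℕ.≤ N →
    ∃ λ B → A ↝ B × B (suc zero) p ≡ 0ℤ × (B zero p ≡ 0ℤ → A zero p ≡ 0ℤ × A (suc zero) p ≡ 0ℤ)
          × (∀ i → B (suc (suc i)) ≈ A (suc (suc i)))
  euclid N A p _ with A (suc zero) p ℤ.≟ 0ℤ
  ... | yes b≡0 = A , ↝-refl , b≡0 , (λ a≡0 → a≡0 , b≡0) , (λ i j → refl)
  euclid zero A p ∣b∣≤0 | no b≢0 = ⊥-elim (b≢0 (ℤ.∣i∣≡0⇒i≡0 (ℕ.n≤0⇒n≡0 ∣b∣≤0)))
  euclid (suc N) A p ∣b∣≤1+N | no b≢0
    with A′ , A↝A′ , A′₀≡b , ∣A′₁∣<∣b∣ , A′≈A ← euclidStep A p b≢0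
    with B , A′↝B , B₁≡0 , B₀≡0⇒ , B≈A′ ← euclid N A′ p (ℕ.≤-pred (ℕ.<-≤-trans ∣A′₁∣<∣b∣ ∣b∣≤1+N))
    = B , ↝-trans A↝A′ A′↝B , B₁≡0 ,
      (λ B₀≡0 → ⊥-elim (b≢0 (trans (sym A′₀≡b) (proj₁ (B₀≡0⇒ B₀≡0))))) ,
      λ i j → trans (B≈A′ i j) (A′≈A i j)

  clearColumn : ∀ (A : Fin (suc r) → ℤ^ d) p →
    ∃ λ B → A ↝ B × (∀ i → B (suc i) p ≡ 0ℤ) × (B zero p ≡ 0ℤ → ∀ i → A i p ≡ 0ℤ)
  clearColumn {zero} A p = A , ↝-refl , (λ ()) , λ { A₀≡0 zero → A₀≡0 }
  clearColumn {suc r} A p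
    with B , A₊↝B , B₊≡0 , B₀≡0⇒ ← clearColumn (A ∘ suc) p
    with C , A↝C , C₀≡A₀ , C₊≡B ← ↝-shift A₊↝B
    with D , C↝D , D₁≡0 , D₀≡0⇒ , D≈C ← euclid ∣ C (suc zero) p ∣ C p ℕ.≤-refl
    = D , ↝-trans A↝C C↝D , D₊≡0 , D₀≡0⇒A≡0
    where
    D₊≡0 : ∀ i → D (suc i) p ≡ 0ℤ
    D₊≡0 zero    = D₁≡0
    D₊≡0 (suc i) = trans (D≈C i p) (trans (cong (λ E → E (suc i) p) C₊≡B) (B₊≡0 i))
    D₀≡0⇒A≡0 : D zero p ≡ 0ℤ → ∀ i → A i p ≡ 0ℤ
    D₀≡0⇒A≡0 D₀≡0 zero    = trans (cong-app (sym C₀≡A₀) p) (proj₁ (D₀≡0⇒ D₀≡0))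
    D₀≡0⇒A≡0 D₀≡0 (suc i) = B₀≡0⇒ (trans (cong (λ E → E zero p) (sym C₊≡B)) (proj₂ (D₀≡0⇒ D₀≡0))) i

  record Echelon (A : Fin r → ℤ^ d) : Set where
    field
      rows      : Fin r → ℤ^ d
      reduction : A ↝ rows
      pivot     : Fin r → Fin d
      upper     : UpperTriangular (selectColumns pivot rows)
      pivot≢0   : ∀ i → rows i (pivot i) ≢ 0ℤ

  echelon : ∀ (A : Fin r → ℤ^ d) → LinearlyIndependent A → Echelon A
  echelon {zero} A _ = record { rows = A ; reduction = ↝-refl ; pivot = λ () ; upper = λ () ; pivot≢0 = λ () }
  echelon {suc r} {d} A independent
    with p , A₀p≢0 ← ¬∀⟶∃¬ d (λ p → A zero p ≡ 0ℤ) (λ p → A zero p ℤ.≟ 0ℤ)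
                           (independent⇒head≉𝟎 {v = A} independent)
    with B , A↝B , B₊≡0 , B₀≡0⇒ ← clearColumn A p
    with E ← echelon (B ∘ suc) (independent-tail {v = B} (↝-independent A↝B independent))
    with C , B↝C , C₀≡B₀ , C₊≡rows ← ↝-shift (Echelon.reduction E)
    = record { rows = C ; reduction = ↝-trans A↝B B↝C ; pivot = p Vector.∷ pivot ; upper = upper′ ; pivot≢0 = pivot≢0′ }
    where
    open Echelon E
    upper′ : UpperTriangular (selectColumns (p Vector.∷ pivot) C)
    upper′ (suc i) zero    _         =
      trans (cong (λ F → F i p) C₊≡rows) (↝-zero-column p reduction B₊≡0 i)
    upper′ (suc i) (suc j) (s≤s j<i) = trans (cong (λ F → F i (pivot j)) C₊≡rows) (upper i j j<i)
    pivot≢0′ : ∀ i → C i ((p Vector.∷ pivot) i) ≢ 0ℤ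
    pivot≢0′ zero    C₀p≡0 = A₀p≢0 (B₀≡0⇒ (trans (cong-app (sym C₀≡B₀) p) C₀p≡0) zero)
    pivot≢0′ (suc i) = subst (λ F → F i (pivot i) ≢ 0ℤ) (sym C₊≡rows) (pivot≢0 i)

  -- Lattices with an upper-triangular basis

  upperTriangular-independent : {P : Mat r} → UpperTriangular P → (∀ i → P i i ≢ 0ℤ) → LinearlyIndependent P
  upperTriangular-independent {suc r} {P} P-upper P≢0 c c·P≈𝟎 = λ { zero → c₀≡0 ; (suc i) → c₊≡0 i }
    where
    c₀*P₀₀≡0 : c zero * P zero zero ≡ 0ℤ
    c₀*P₀₀≡0 = begin
      c zero * P zero zero                                       ≡⟨ ℤ.+-identityʳ _ ⟨
      c zero * P zero zero + 0ℤ                                  ≡⟨ cong (_+_ (c zero * P zero zero)) first-column ⟨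
      c zero * P zero zero + lincomb (c ∘ suc) (P ∘ suc) zero    ≡⟨ c·P≈𝟎 zero ⟩
      0ℤ                                                         ∎
      where
      first-column = lincomb-vanishes (c ∘ suc) (P ∘ suc) zero (λ i → P-upper (suc i) zero (s≤s z≤n))
    c₀≡0 : c zero ≡ 0ℤ
    c₀≡0 = Sum.[ id , ⊥-elim ∘ P≢0 zero ]′ (ℤ.i*j≡0⇒i≡0∨j≡0 (c zero) c₀*P₀₀≡0)
    c₊≡0 : ∀ i → c (suc i) ≡ 0ℤ
    c₊≡0 = upperTriangular-independent (λ i j j<i → P-upper (suc i) (suc j) (s≤s j<i)) (P≢0 ∘ suc) (c ∘ suc)
      λ j → begin
        lincomb (c ∘ suc) (lowerRight P) j                        ≡⟨ lincomb-∘ (c ∘ suc) (P ∘ suc) suc j ⟨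
        lincomb (c ∘ suc) (P ∘ suc) (suc j)                       ≡⟨ ℤ.+-identityˡ _ ⟨
        0ℤ + lincomb (c ∘ suc) (P ∘ suc) (suc j)
          ≡⟨ cong (λ x → x * P zero (suc j) + lincomb (c ∘ suc) (P ∘ suc) (suc j)) c₀≡0 ⟨
        c zero * P zero (suc j) + lincomb (c ∘ suc) (P ∘ suc) (suc j) ≡⟨ c·P≈𝟎 (suc j) ⟩
        0ℤ                                                        ∎

  -- Mixed-radix encoding of a canonical representative of x modulo the rows of P.
  reduce : (P : Mat r) → (∀ i → P i i ≢ 0ℤ) → ℤ^ r → Fin (∏∣diag∣ P)
  reduce {zero}  P _   x = zero
  reduce {suc r} P P≢0 x = combine remainder (reduce (lowerRight P) (P≢0 ∘ suc) ((x ⊕ quotient · P zero) ∘ suc))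
    where open Division (x zero) (P zero zero) (P≢0 zero)

  reduce-injective-mod : {P : Mat r} (P-upper : UpperTriangular P) (P≢0 : ∀ i → P i i ≢ 0ℤ) (x y : ℤ^ r) →
    reduce P P≢0 x ≡ reduce P P≢0 y → InSpan P (x ⊝ y)
  reduce-injective-mod {zero} _ _ x y _ = (λ ()) , λ ()
  reduce-injective-mod {suc r} {P} P-upper P≢0 x y same
    with rx≡ry , rest≡ ← combine-injective _ _ _ _ same
    with c , c·P₊≈ ← reduce-injective-mod (λ i j j<i → P-upper (suc i) (suc j) (s≤s j<i)) (P≢0 ∘ suc) _ _ rest≡
    = (qy - qx) Vector.∷ c , coordinates
    where
    module X = Division (x zero) (P zero zero) (P≢0 zero)
    module Y = Division (y zero) (P zero zero) (P≢0 zero)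
    qx = X.quotient
    qy = Y.quotient
    same-remainder : x zero + qx * P zero zero ≡ y zero + qy * P zero zero
    same-remainder = trans X.a+quotient*b≡remainder (trans (cong (+_ ∘ toℕ) rx≡ry) (sym Y.a+quotient*b≡remainder))
    coordinates : lincomb ((qy - qx) Vector.∷ c) P ≈ (x ⊝ y)
    coordinates zero = begin
      (qy - qx) * P zero zero + lincomb c (P ∘ suc) zero   ≡⟨ cong (_+_ ((qy - qx) * P zero zero)) first-column ⟩
      (qy - qx) * P zero zero + 0ℤ                         ≡⟨ regroup (x zero) (y zero) qx qy (P zero zero) ⟩
      (x zero - y zero) + ((y zero + qy * P zero zero) - (x zero + qx * P zero zero))
        ≡⟨ cong (λ z → (x zero - y zero) + (z - (x zero + qx * P zero zero))) same-remainder ⟨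
      (x zero - y zero) + ((x zero + qx * P zero zero) - (x zero + qx * P zero zero))
        ≡⟨ cong (_+_ (x zero - y zero)) (ℤ.+-inverseʳ (x zero + qx * P zero zero)) ⟩
      (x zero - y zero) + 0ℤ                               ≡⟨ ℤ.+-identityʳ _ ⟩
      x zero - y zero                                      ∎
      where
      first-column = lincomb-vanishes c (P ∘ suc) zero (λ i → P-upper (suc i) zero (s≤s z≤n))
      regroup : ∀ x y qx qy g → (qy - qx) * g + 0ℤ ≡ (x - y) + ((y + qy * g) - (x + qx * g))
      regroup = solve-∀
    coordinates (suc j) = begin
      (qy - qx) * P zero (suc j) + lincomb c (P ∘ suc) (suc j)
        ≡⟨ cong (_+_ ((qy - qx) * P zero (suc j))) (lincomb-∘ c (P ∘ suc) suc j) ⟩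
      (qy - qx) * P zero (suc j) + lincomb c (lowerRight P) j   ≡⟨ cong (_+_ ((qy - qx) * P zero (suc j))) (c·P₊≈ j) ⟩
      (qy - qx) * P zero (suc j) + ((x (suc j) + qx * P zero (suc j)) - (y (suc j) + qy * P zero (suc j)))
        ≡⟨ cancel qx qy (P zero (suc j)) (x (suc j)) (y (suc j)) ⟩
      x (suc j) - y (suc j)                                     ∎
      where
      cancel : ∀ qx qy g x y → (qy - qx) * g + ((x + qx * g) - (y + qy * g)) ≡ x - y
      cancel = solve-∀

  cosets≤∏∣diag∣ : {P : Mat r} → UpperTriangular P → (P≢0 : ∀ i → P i i ≢ 0ℤ) → (v : Fin m → ℤ^ r) →
    (∀ a b → InSpan P (v a ⊝ v b) → a ≡ b) → m ℕ.≤ ∏∣diag∣ P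
  cosets≤∏∣diag∣ P-upper P≢0 v separated =
    injective⇒≤ λ {a} {b} same → separated a b (reduce-injective-mod P-upper P≢0 (v a) (v b) same)

  lincomb-coordinates : {e : Fin d → ℤ^ n} {s : Fin r → ℤ^ n} {A : Fin r → ℤ^ d} →
    (∀ i → lincomb (A i) e ≈ s i) → ∀ c → lincomb c s ≈ lincomb (lincomb c A) e
  lincomb-coordinates {e = e} {A = A} A-coordinates c j =
    trans (sym (lincomb-cong (λ _ → refl) A-coordinates j)) (lincomb-assoc c A e j)

  InSpan-coordinates : {e : Fin d → ℤ^ n} {s : Fin r → ℤ^ n} {A : Fin r → ℤ^ d} →
    (∀ i → lincomb (A i) e ≈ s i) → ∀ {w} → InSpan A w → InSpan s (lincomb w e)
  InSpan-coordinates {e = e} {A = A} A-coordinates (c , c·A≈w) =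
    c , λ j → trans (lincomb-coordinates {e = e} {A = A} A-coordinates c j) (lincomb-cong c·A≈w (λ _ _ → refl) j)

  InSpan-coordinates⁻ : {e : Fin d → ℤ^ n} {s : Fin r → ℤ^ n} {A : Fin r → ℤ^ d} → LinearlyIndependent e →
    (∀ i → lincomb (A i) e ≈ s i) → ∀ {w} → InSpan s (lincomb w e) → InSpan A w
  InSpan-coordinates⁻ {e = e} {A = A} e-independent A-coordinates (c , c·s≈w·e) =
    c , lincomb-injective e-independent (λ j → trans (sym (lincomb-coordinates {e = e} {A = A} A-coordinates c j)) (c·s≈w·e j))

  coordinates-independent : {e : Fin d → ℤ^ n} {s : Fin r → ℤ^ n} {A : Fin r → ℤ^ d} →
    (∀ i → lincomb (A i) e ≈ s i) → LinearlyIndependent s → LinearlyIndependent A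
  coordinates-independent {e = e} {A = A} A-coordinates s-independent c c·A≈𝟎 = s-independent c λ j →
    trans (lincomb-coordinates {e = e} {A = A} A-coordinates c j) (trans (lincomb-cong c·A≈𝟎 (λ _ _ → refl) j) (lincomb-𝟎 e j))

  echelon-pivots-determine : {A : Fin r → ℤ^ d} (E : Echelon A) → let open Echelon E in
    ∀ {x} → InSpan rows x → (x ∘ pivot) ≈ 𝟎 → x ≈ 𝟎
  echelon-pivots-determine E {x} (c , c·rows≈x) x∘pivot≈𝟎 j =
    trans (sym (c·rows≈x j)) (trans (lincomb-cong c≈𝟎 (λ _ _ → refl) j) (lincomb-𝟎 rows j))
    where
    open Echelon E
    c≈𝟎 : c ≈ 𝟎
    c≈𝟎 = upperTriangular-independent upper pivot≢0 c λ i →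
      trans (sym (lincomb-∘ c rows pivot i)) (trans (c·rows≈x (pivot i)) (x∘pivot≈𝟎 i))

  module _ {s : Fin r → ℤ^ n} {Z : ℤ^ n → Set} (Z-subgroup : IsSubgroup Z) (Y⊆Z : ∀ x → InSpan s x → Z x)
           {t : Fin m → ℤ^ n} (transversal : IsTransversal Z s t)
           {e : Fin d → ℤ^ n} (e-basis : IsBasis e) {A : Fin r → ℤ^ d} (A-coordinates : ∀ i → lincomb (A i) e ≈ s i)
           (E : Echelon A) where
    open IsSubgroup Z-subgroup
    open Echelon E

    Z-pivots-determine : ∀ w → Z (lincomb w e) → (w ∘ pivot) ≈ 𝟎 → w ≈ 𝟎
    Z-pivots-determine w Zw w∘pivot≈𝟎 j
      with N , N≢0 , N·w∈Y ← nonzero-multiple-in-span Z-subgroup (proj₁ (proj₂ transversal)) Zw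
      = Sum.[ ⊥-elim ∘ N≢0 , id ]′ (ℤ.i*j≡0⇒i≡0∨j≡0 N (N·w≈𝟎 j))
      where
      N·w∈A : InSpan A (N · w)
      N·w∈A = InSpan-coordinates⁻ (proj₁ e-basis) A-coordinates (InSpan-resp (λ j → sym (lincomb-· N w e j)) N·w∈Y)
      N·w≈𝟎 : N · w ≈ 𝟎
      N·w≈𝟎 = echelon-pivots-determine E (↝-InSpan⁻ reduction N·w∈A)
        (λ i → trans (cong (N *_) (w∘pivot≈𝟎 i)) (ℤ.*-zeroʳ N))

    coordinates : ℤ^ n → ℤ^ d
    coordinates x = proj₁ (proj₂ e-basis x)

    pivot-coordinates-separate : ∀ a b →
      InSpan (selectColumns pivot rows) ((coordinates (t a) ⊝ coordinates (t b)) ∘ pivot) → a ≡ b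
    pivot-coordinates-separate a b (c , c·P≈w∘pivot) = proj₂ (proj₂ transversal) a b (InSpan-resp ta-tb≈y·e y∈Y)
      where
      coordinates-spec : ∀ x → lincomb (coordinates x) e ≈ x
      coordinates-spec x = proj₂ (proj₂ e-basis x)
      w y : ℤ^ d
      w = coordinates (t a) ⊝ coordinates (t b)
      y = lincomb c rows
      y∈Y : InSpan s (lincomb y e)
      y∈Y = InSpan-coordinates A-coordinates (↝-InSpan reduction (c , λ _ → refl))
      w·e≈ta-tb : lincomb w e ≈ (t a ⊝ t b)
      w·e≈ta-tb j = trans (lincomb-⊝ _ _ e j) (cong₂ _-_ (coordinates-spec (t a) j) (coordinates-spec (t b) j))
      w-y∈Z : Z (lincomb (w ⊝ y) e)
      w-y∈Z = resp (λ j → sym (trans (lincomb-⊝ w y e j) (cong (_- lincomb y e j) (w·e≈ta-tb j))))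
        (add-mem (add-mem (proj₁ transversal a) (neg-mem (proj₁ transversal b))) (neg-mem (Y⊆Z _ y∈Y)))
      w-y≈𝟎 : (w ⊝ y) ≈ 𝟎
      w-y≈𝟎 = Z-pivots-determine (w ⊝ y) w-y∈Z λ i →
        trans (cong (_-_ (w (pivot i))) (trans (lincomb-∘ c rows pivot i) (c·P≈w∘pivot i))) (ℤ.+-inverseʳ (w (pivot i)))
      ta-tb≈y·e : lincomb y e ≈ (t a ⊝ t b)
      ta-tb≈y·e j = trans (sym (lincomb-cong (λ i → ℤ.i-j≡0⇒i≡j _ _ (w-y≈𝟎 i)) (λ _ _ → refl) j)) (w·e≈ta-tb j)

    index≤∏∣diag∣ : m ℕ.≤ ∏∣diag∣ (selectColumns pivot rows)
    index≤∏∣diag∣ = cosets≤∏∣diag∣ upper pivot≢0 (λ a → coordinates (t a) ∘ pivot) pivot-coordinates-separate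

open IndexBound
open import Data.Nat using (ℕ; _≤_; _*_; _^_; _!)
open import Data.Nat.Properties using (module ≤-Reasoning)
open import Data.Fin using (Fin)
open import Data.Integer using (ℤ; ∣_∣)
open import Data.Product using (_,_; proj₁; proj₂)
open import Relation.Binary.PropositionalEquality using (cong)

lemmaA2 : (n r k m : ℕ) → 1 ≤ k → (s : Fin r → ℤ^ n) →
    KBounded k s → LinearlyIndependent s →
    (Z : ℤ^ n → Set) → IsSubgroup Z → (∀ x → InSpan s x → Z x) →
    (t : Fin m → ℤ^ n) → IsTransversal Z s t →
    m ≤ (r !) * k ^ r
lemmaA2 n r k m _ s (d , e , e-basis , s-bounded) s-independent Z Z-subgroup Y⊆Z t transversal = begin
  m                                  ≤⟨ index≤∏∣diag∣ Z-subgroup Y⊆Z transversal e-basis A-coordinates E ⟩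
  ∏∣diag∣ (selectColumns pivot rows) ≡⟨ ∣det∣≡∏∣diag∣ upper ⟨
  ∣ det (selectColumns pivot rows) ∣ ≡⟨ cong ∣_∣ (↝-det pivot reduction) ⟩
  ∣ det (selectColumns pivot A) ∣    ≤⟨ ∣det∣≤n!*k^n k (λ i j → proj₁ (proj₂ (s-bounded i)) (pivot j)) ⟩
  r ! * k ^ r                        ∎
  where
  open ≤-Reasoning
  A : Fin r → ℤ^ d
  A i = proj₁ (s-bounded i)
  A-coordinates : ∀ i → lincomb (A i) e ≈ s i
  A-coordinates i = proj₂ (proj₂ (s-bounded i))
  E : Echelon A
  E = echelon A (coordinates-independent A-coordinates s-independent)
  open Echelon E
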